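{- Let $G=(V,E_\mathrm{D}\cup E_\mathrm{U})$ be an acyclic mixed graph and $P\subseteq V\times V$ a set of requests, each request $(s,t)\in P$ being associated with a fixed shortest path $p$ from $s$ to $t$ in $G$. Let $v\in V$, let $P_v$ be the set of associated paths that contain $v$, and let $P'_v$ be the corresponding set of local paths. If some orientation of the local neighborhood $G_v$ satisfies every local path in a set $S'\subseteq P'_v$, then there is an orientation of $G$ that satisfies the corresponding set $S\subseteq P_v$ of global paths, i.e. for every $p\in P_v$ whose local path lies in $S'$, the orientation contains a directed path from the source of $p$ to the target of $p$.
   Context: A mixed graph $G=(V,E_\mathrm{D}\cup E_\mathrm{U})$ has a set $E_\mathrm{D}$ of directed edges and a set $E_\mathrm{U}$ of undirected edges. An orientation of $G$ is the directed graph obtained by choosing a single direction for each undirected edge, keeping the directed edges unchanged. A path from $s$ to $t$ in $G$ is a sequence of distinct vertices starting at $s$ and ending at $t$ in which every two consecutive vertices are joined either by an undirected edge or by a directed edge pointing forward along the sequence. A shortest path is such a path with the minimum number of edges; if there are several, one of them is chosen arbitrarily. $G$ is called acyclic if it has no cycle that can be traversed using undirected edges in either direction and directed edges only in their own direction; equivalently, every connected component of $(V,E_\mathrm{U})$ is a tree, and contracting each such component to a single vertex yields a directed graph with no directed cycles and no loops. The local neighborhood $G_v$ of a vertex $v$ is the star subgraph consisting of $v$, all edges (directed or undirected) incident to $v$, and all vertices adjacent to $v$. For a path $p\in P_v$ with endpoints $s,t$, its local path $p'$ is the intersection of $p$ with $G_v$, and its local endpoints $s',t'$ are the vertices of $p'$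 closest along $p$ to $s$ and to $t$, respectively. An orientation of $G_v$ satisfies the local path $p'$ if it contains a directed path from $s'$ to $t'$. -}

module Defs where

open import Data.Nat using (ℕ; _≤_)
open import Data.Fin using (Fin)
open import Data.Bool using (Bool; true; false)
open import Data.Maybe using (just)
open import Data.List using (List; []; _∷_; _++_; length; head; last)
open import Data.List.Relation.Unary.All using (All)
open import Data.List.Relation.Unary.Linked using (Linked)
open import Data.List.Relation.Unary.Unique.Propositional using (Unique)
open import Data.Product using (Σ; Σ-syntax; _×_; _,_)
open import Data.Sum using (_⊎_)
open import Relation.Binary.PropositionalEquality using (_≡_; _≢_)
open import Relation.Nullary using (¬_)

data Edge (n : ℕ) : Set where
  dir   : Fin n → Fin n → Edge n
  undir : Fin n → Fin n → Edge n

-- A mixed graph: vertices Fin n, edges indexed by Fin m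
-- (E_D = the dir-edges, E_U = the undir-edges).
record MixedGraph (n : ℕ) : Set where
  field
    m    : ℕ
    edge : Fin m → Edge n
open MixedGraph public

data Permits {n : ℕ} : Edge n → Fin n → Fin n → Set where
  dirP  : ∀ {a b} → Permits (dir a b) a b
  undP₁ : ∀ {a b} → Permits (undir a b) a b
  undP₂ : ∀ {a b} → Permits (undir a b) b a

data Joins {n : ℕ} : Edge n → Fin n → Fin n → Set where
  dirJ₁ : ∀ {a b} → Joins (dir a b) a b
  dirJ₂ : ∀ {a b} → Joins (dir a b) b a
  undJ₁ : ∀ {a b} → Joins (undir a b) a b
  undJ₂ : ∀ {a b} → Joins (undir a b) b a

Incident : ∀ {n} → Fin n → Edge n → Set
Incident v e = Σ _ λ w → Joins e v w

data Walk {n : ℕ} (G : MixedGraph n) : Fin n → Fin n → List (Fin n) → List (Fin (m G)) → Set where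
  here : ∀ {a} → Walk G a a (a ∷ []) []
  step : ∀ {a b c vs es} (i : Fin (m G)) → Permits (edge G i) a b →
         Walk G b c vs es → Walk G a c (a ∷ vs) (i ∷ es)

-- a cycle: a closed walk a → … → a of length ≥ 1 with pairwise distinct
-- vertices (rest lists each vertex of the cycle once, ending in a) and
-- pairwise distinct edges
Cycle : ∀ {n} → MixedGraph n → Set
Cycle {n} G = Σ[ a ∈ Fin n ] Σ[ rest ∈ List (Fin n) ] Σ[ es ∈ List (Fin (m G)) ]
  (Walk G a a (a ∷ rest) es × rest ≢ [] × Unique rest × Unique es)

Acyclic : ∀ {n} → MixedGraph n → Set
Acyclic G = ¬ Cycle G

IsPathIn : ∀ {n} → (Fin n → Fin n → Set) → Fin n → Fin n → List (Fin n) → Set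
IsPathIn R s t xs = Unique xs × Linked R xs × head xs ≡ just s × last xs ≡ just t

Adj : ∀ {n} → MixedGraph n → Fin n → Fin n → Set
Adj G a b = Σ[ i ∈ Fin (m G) ] Permits (edge G i) a b

IsPath : ∀ {n} → MixedGraph n → Fin n → Fin n → List (Fin n) → Set
IsPath G = IsPathIn (Adj G)

-- shortest path: a path with the minimum number of edges (= vertices - 1)
IsShortestPath : ∀ {n} → MixedGraph n → Fin n → Fin n → List (Fin n) → Set
IsShortestPath G s t p =
  IsPath G s t p × (∀ q → IsPath G s t q → length p ≤ length q)

data OArc {n : ℕ} : Edge n → Bool → Fin n → Fin n → Set where
  dirA : ∀ {a b d} → OArc (dir a b) d a b
  fwdA : ∀ {a b} → OArc (undir a b) true a b
  bwdA : ∀ {a b} → OArc (undir a b) false b a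

-- an orientation of G: a direction for each edge (ignored on directed ones)
Orientation : ∀ {n} → MixedGraph n → Set
Orientation G = Fin (m G) → Bool

Arc : ∀ {n} (G : MixedGraph n) → Orientation G → Fin n → Fin n → Set
Arc G o a b = Σ[ i ∈ Fin (m G) ] OArc (edge G i) (o i) a b

HasDirPath : ∀ {n} (G : MixedGraph n) → Orientation G → Fin n → Fin n → Set
HasDirPath G o s t = Σ[ q ∈ List _ ] IsPathIn (Arc G o) s t q

-- Local neighbourhood G_v (star: v, edges incident to v, their endpoints)

InLocal : ∀ {n} → MixedGraph n → Fin n → Fin n → Set
InLocal G v x = x ≡ v ⊎ Σ[ i ∈ Fin (m G) ] Joins (edge G i) v x

LocalOrientation : ∀ {n} → MixedGraph n → Fin n → Set
LocalOrientation G v = (i : Fin (m G)) → Incident v (edge G i) → Bool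

LocalArc : ∀ {n} (G : MixedGraph n) (v : Fin n) → LocalOrientation G v → Fin n → Fin n → Set
LocalArc G v o a b =
  Σ[ i ∈ Fin (m G) ] Σ[ inc ∈ Incident v (edge G i) ] OArc (edge G i) (o i inc) a b

IsFirst : ∀ {n} → (Fin n → Set) → List (Fin n) → Fin n → Set
IsFirst P p x = Σ[ pre ∈ List _ ] Σ[ post ∈ List _ ]
  (p ≡ pre ++ x ∷ post × P x × All (λ y → ¬ P y) pre)

IsLast : ∀ {n} → (Fin n → Set) → List (Fin n) → Fin n → Set
IsLast P p x = Σ[ pre ∈ List _ ] Σ[ post ∈ List _ ]
  (p ≡ pre ++ x ∷ post × P x × All (λ y → ¬ P y) post)

-- the local orientation o satisfies the local path p' of p (p' = p ∩ G_v):
-- it contains a directed path from the local endpoint s' (vertex of p ∩ G_v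
-- closest to s along p) to the local endpoint t' (closest to t)
SatisfiesLocal : ∀ {n} (G : MixedGraph n) (v : Fin n) → LocalOrientation G v → List (Fin n) → Set
SatisfiesLocal G v o p = ∀ s' t' → IsFirst (InLocal G v) p s' → IsLast (InLocal G v) p t' →
  Σ[ q ∈ List _ ] IsPathIn (LocalArc G v o) s' t' q

-- Orient every edge at v as the given orientation o′ of G_v does, and every other undirected
-- edge in the direction in which some request path traverses it before its first vertex u in
-- G_v (when o′ has an arc u → v) or after its last vertex w in G_v (when o′ has an arc v → w).
-- No edge is forced both ways: two shortest paths that still have to reach v (or that have
-- already left v) and traverse an edge in opposite directions could each be shortened through
-- the other; and if the part of one path before G_v met the part of another path after G_v,
-- these pieces together with the arcs u → v and v → w would close a cycle in G.  A request
-- path p is then satisfied by its part up to its first vertex s′ in G_v, followed by the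
-- directed local path from s′ to t′ and the part of p from its last vertex t′ in G_v on.

module Submission where

open import Defs
open import Data.Bool using (Bool; true; false)
open import Data.Empty using (⊥; ⊥-elim)
open import Data.Fin using (Fin)
open import Data.Fin.Properties using (_≟_; any?)
open import Data.List using (List; []; _∷_; _++_; length; head; last; [_])
open import Data.List.Properties using (++-assoc; length-++; ∷-injectiveˡ; ∷-injectiveʳ)
open import Data.List.Membership.Propositional using (_∈_; _∉_)
open import Data.List.Membership.Propositional.Properties using (∈-++⁺ˡ; ∈-++⁺ʳ; ∈-++⁻; ∈-∃++)
open import Data.List.Relation.Binary.Subset.Propositional using (_⊆_)
open import Data.List.Relation.Binary.Subset.Propositional.Properties using (∷⁺ʳ)
open import Data.List.Relation.Unary.All as All using (All; []; _∷_)
open import Data.List.Relation.Unary.All.Properties using (¬Any⇒All¬; All¬⇒¬Any) renaming (++⁻ˡ to All-++⁻ˡ)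
open import Data.List.Relation.Unary.Any as Any using (Any; here; there)
open import Data.List.Relation.Unary.AllPairs as AllPairs using ([]; _∷_)
open import Data.List.Relation.Unary.Linked as Linked using (Linked; []; [-]; _∷_)
open import Data.List.Relation.Unary.Unique.Propositional using (Unique)
open import Data.List.Relation.Unary.Unique.Propositional.Properties using () renaming (++⁺ to Unique-++⁺)
open import Data.Maybe using (Maybe; just; nothing)
open import Data.Maybe.Properties using (just-injective)
open import Data.Nat using (ℕ; suc; _+_; _≤_; z≤n; s≤s; s≤s⁻¹)
open import Data.Nat.Properties using (≤-trans; m≤n⇒m≤1+n; n≤1+n; +-cancelˡ-≤; +-cancelʳ-≤; +-comm; <-asym)
open import Data.Product using (Σ-syntax; ∃₂; _×_; _,_; proj₁; proj₂)
open import Data.Sum using (_⊎_; inj₁; inj₂; [_,_]′)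
open import Relation.Binary.Definitions using (DecidableEquality)
open import Relation.Binary.PropositionalEquality using (_≡_; _≢_; refl; sym; trans; cong; subst; subst₂; module ≡-Reasoning)
open import Function using (_∘_)
open import Relation.Nullary using (¬_; Dec; yes; no; does)
open import Relation.Nullary.Decidable using (map′; _×-dec_; _⊎-dec_; ¬?)

module _ {A : Set} where

  Unique-∷⁺ : ∀ {x : A} {xs} → x ∉ xs → Unique xs → Unique (x ∷ xs)
  Unique-∷⁺ {xs = xs} x∉xs u = ¬Any⇒All¬ xs x∉xs ∷ u

  Unique-++⁻ˡ : ∀ (xs : List A) {ys} → Unique (xs ++ ys) → Unique xs
  Unique-++⁻ˡ []       _         = []
  Unique-++⁻ˡ (x ∷ xs) (x∉ ∷ u) = All-++⁻ˡ xs x∉ ∷ Unique-++⁻ˡ xs u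

  Unique-++⁻ʳ : ∀ (xs : List A) {ys} → Unique (xs ++ ys) → Unique ys
  Unique-++⁻ʳ []       u       = u
  Unique-++⁻ʳ (x ∷ xs) (_ ∷ u) = Unique-++⁻ʳ xs u

  Unique-++⇒disjoint : ∀ (xs : List A) {ys z} → Unique (xs ++ ys) → z ∈ xs → z ∉ ys
  Unique-++⇒disjoint (x ∷ xs) (x∉ ∷ _) (here refl) z∈ys = All¬⇒¬Any x∉ (∈-++⁺ʳ xs z∈ys)
  Unique-++⇒disjoint (x ∷ xs) (_ ∷ u)  (there z∈xs)    = Unique-++⇒disjoint xs u z∈xs

  Unique-split-suffix : ∀ (xs xs′ : List A) {x ys ys′} → Unique (xs ++ x ∷ ys) →
                        xs ++ x ∷ ys ≡ xs′ ++ x ∷ ys′ → ys ≡ ys′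
  Unique-split-suffix []       []         _         refl = refl
  Unique-split-suffix []       (y ∷ xs′) (x∉ ∷ _) refl = ⊥-elim (All¬⇒¬Any x∉ (∈-++⁺ʳ xs′ (here refl)))
  Unique-split-suffix (y ∷ xs) []         (x∉ ∷ _) refl = ⊥-elim (All¬⇒¬Any x∉ (∈-++⁺ʳ xs (here refl)))
  Unique-split-suffix (y ∷ xs) (y′ ∷ xs′) (_ ∷ u)  eq   = Unique-split-suffix xs xs′ u (∷-injectiveʳ eq)

  ++-∷-suffix : ∀ (xs : List A) {ys} zs {w ws} → xs ++ ys ≡ zs ++ w ∷ ws → w ∉ xs →
                Σ[ ks ∈ List A ] ys ≡ ks ++ w ∷ ws
  ++-∷-suffix []       zs       eq _   = zs , eq
  ++-∷-suffix (x ∷ xs) []       eq w∉ = ⊥-elim (w∉ (here (sym (∷-injectiveˡ eq))))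
  ++-∷-suffix (x ∷ xs) (z ∷ zs) eq w∉ = ++-∷-suffix xs zs (∷-injectiveʳ eq) (w∉ ∘ there)

  head-++-∷ : ∀ (xs : List A) {x ys ys′} → head (xs ++ x ∷ ys) ≡ head (xs ++ x ∷ ys′)
  head-++-∷ []      = refl
  head-++-∷ (_ ∷ _) = refl

  last-++-∷ : ∀ (xs : List A) {x ys} → last (xs ++ x ∷ ys) ≡ last (x ∷ ys)
  last-++-∷ []           = refl
  last-++-∷ (_ ∷ [])     = refl
  last-++-∷ (_ ∷ y ∷ xs) = last-++-∷ (y ∷ xs)

  last≡just⇒∷ʳ : ∀ (xs : List A) {x} → last xs ≡ just x → Σ[ ys ∈ List A ] xs ≡ ys ++ [ x ]
  last≡just⇒∷ʳ (y ∷ [])     refl = [] , refl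
  last≡just⇒∷ʳ (y ∷ z ∷ xs) eq   with last≡just⇒∷ʳ (z ∷ xs) eq
  ... | ys , eq′ = y ∷ ys , cong (y ∷_) eq′

  length-++-cancel : ∀ (xs ys ys′ zs : List A) →
                     length (xs ++ ys ++ zs) ≤ length (xs ++ ys′ ++ zs) → length ys ≤ length ys′
  length-++-cancel xs ys ys′ zs le = +-cancelʳ-≤ (length zs) (length ys) (length ys′)
    (+-cancelˡ-≤ (length xs) _ _ (subst₂ _≤_ (lengths ys) (lengths ys′) le))
    where
    lengths : ∀ us → length (xs ++ us ++ zs) ≡ length xs + (length us + length zs)
    lengths us = trans (length-++ xs) (cong (length xs +_) (length-++ us))

  last-splice : ∀ xs {x ys y} zs → last (x ∷ ys) ≡ just y → last (xs ++ (x ∷ ys) ++ zs) ≡ last (y ∷ zs)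
  last-splice xs {x} {ys} {y} zs la with last≡just⇒∷ʳ (x ∷ ys) la
  ... | ws , eq = begin
    last (xs ++ (x ∷ ys) ++ zs)       ≡⟨ cong (λ l → last (xs ++ l ++ zs)) eq ⟩
    last (xs ++ (ws ++ [ y ]) ++ zs)  ≡⟨ cong (λ l → last (xs ++ l)) (++-assoc ws [ y ] zs) ⟩
    last (xs ++ ws ++ y ∷ zs)         ≡⟨ cong last (sym (++-assoc xs ws (y ∷ zs))) ⟩
    last ((xs ++ ws) ++ y ∷ zs)       ≡⟨ last-++-∷ (xs ++ ws) ⟩
    last (y ∷ zs)                     ∎
    where open ≡-Reasoning

  module _ {R : A → A → Set} where

    Linked-++⁺ : ∀ xs {y ys} → Linked R (xs ++ [ y ]) → Linked R (y ∷ ys) → Linked R (xs ++ y ∷ ys)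
    Linked-++⁺ []           _        r = r
    Linked-++⁺ (x ∷ [])     (rx ∷ _) r = rx ∷ r
    Linked-++⁺ (x ∷ x′ ∷ xs) (rx ∷ l) r = rx ∷ Linked-++⁺ (x′ ∷ xs) l r

    Linked-++⁻ˡ : ∀ xs {y ys} → Linked R (xs ++ y ∷ ys) → Linked R (xs ++ [ y ])
    Linked-++⁻ˡ []            _        = [-]
    Linked-++⁻ˡ (x ∷ [])      (rx ∷ _) = rx ∷ [-]
    Linked-++⁻ˡ (x ∷ x′ ∷ xs) (rx ∷ l) = rx ∷ Linked-++⁻ˡ (x′ ∷ xs) l

    Linked-++⁻ʳ : ∀ xs {ys} → Linked R (xs ++ ys) → Linked R ys
    Linked-++⁻ʳ []       l = l
    Linked-++⁻ʳ (x ∷ xs) l = Linked-++⁻ʳ xs (Linked.tail l)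

    Linked-last-step : ∀ {x y ys z} → Linked R (x ∷ y ∷ ys) → last (y ∷ ys) ≡ just z →
                       Σ[ w ∈ A ] R w z
    Linked-last-step {ys = []}    (r ∷ _) refl = _ , r
    Linked-last-step {ys = _ ∷ _} (_ ∷ l) eq   = Linked-last-step l eq

    Linked-predecessor : ∀ xs {y ys} → xs ≢ [] → Linked R (xs ++ y ∷ ys) → Σ[ x ∈ A ] x ∈ xs × R x y
    Linked-predecessor []            xs≢[] _       = ⊥-elim (xs≢[] refl)
    Linked-predecessor (x ∷ [])      _     (r ∷ _) = x , here refl , r
    Linked-predecessor (_ ∷ x ∷ xs)  _     (_ ∷ l) with Linked-predecessor (x ∷ xs) (λ ()) l
    ... | z , z∈ , r = z , there z∈ , r

    Linked-successor : ∀ xs {y ys} → ys ≢ [] → Linked R (xs ++ y ∷ ys) → Σ[ z ∈ A ] z ∈ ys × R y z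
    Linked-successor xs {ys = []}    ys≢[] _ = ⊥-elim (ys≢[] refl)
    Linked-successor xs {ys = z ∷ _} _     l with Linked-++⁻ʳ xs l
    ... | r ∷ _ = z , here refl , r

    Linked-∷ʳ-cases : ∀ xs {y} → (xs ≢ [] → Linked R (xs ++ [ y ])) → Linked R (xs ++ [ y ])
    Linked-∷ʳ-cases []      _ = [-]
    Linked-∷ʳ-cases (_ ∷ _) f = f (λ ())

    Linked-∷-cases : ∀ {x} xs → (xs ≢ [] → Linked R (x ∷ xs)) → Linked R (x ∷ xs)
    Linked-∷-cases []      _ = [-]
    Linked-∷-cases (_ ∷ _) f = f (λ ())

    Linked-splice : ∀ xs {x ys y} zs → Linked R (xs ++ [ x ]) → Linked R (x ∷ ys) →
                    last (x ∷ ys) ≡ just y → Linked R (y ∷ zs) → Linked R (xs ++ (x ∷ ys) ++ zs)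
    Linked-splice xs {x} {ys} zs l₁ l₂ la l₃ with last≡just⇒∷ʳ (x ∷ ys) la
    ... | ws , eq = Linked-++⁺ xs l₁ (subst (Linked R) (sym middle) (Linked-++⁺ ws (subst (Linked R) eq l₂) l₃))
      where
      middle : (x ∷ ys) ++ zs ≡ ws ++ _ ∷ zs
      middle = trans (cong (_++ zs) eq) (++-assoc ws [ _ ] zs)

  module _ (_≟ᴬ_ : DecidableEquality A) {R : A → A → Set} where
    open import Data.List.Membership.DecPropositional _≟ᴬ_ using (_∈?_)

    shortcut : ∀ x xs → Linked R (x ∷ xs) →
               Σ[ zs ∈ List A ] Unique (x ∷ zs) × Linked R (x ∷ zs) ×
                 last (x ∷ zs) ≡ last (x ∷ xs) × length zs ≤ length xs × x ∷ zs ⊆ x ∷ xs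
    shortcut x []       _       = [] , [] ∷ [] , [-] , refl , z≤n , λ z∈ → z∈
    shortcut x (y ∷ xs) (r ∷ l) with shortcut y xs l
    ... | zs , u , lz , la , le , sub with x ∈? y ∷ zs
    ... | no x∉ = y ∷ zs , Unique-∷⁺ x∉ u , r ∷ lz , la , s≤s le , ∷⁺ʳ x sub
    ... | yes x∈ with ∈-∃++ x∈
    ...   | ws , ws′ , eq =
      ws′ , Unique-++⁻ʳ ws (subst Unique eq u) , Linked-++⁻ʳ ws (subst (Linked R) eq lz) ,
      trans (sym (last-++-∷ ws)) (trans (cong last (sym eq)) la) ,
      ≤-trans (length-suffix ws) (subst (λ zs′ → length zs′ ≤ suc (length xs)) eq (s≤s le)) ,
      λ { (here refl) → here refl ; (there z∈) → there (sub (subst (_ ∈_) (sym eq) (∈-++⁺ʳ ws (there z∈)))) }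
      where
      length-suffix : ∀ (us : List A) {u vs} → length vs ≤ length (us ++ u ∷ vs)
      length-suffix []       = n≤1+n _
      length-suffix (_ ∷ us) = m≤n⇒m≤1+n (length-suffix us)

  data Consecutive (a b : A) : List A → Set where
    here  : ∀ {xs} → Consecutive a b (a ∷ b ∷ xs)
    there : ∀ {x xs} → Consecutive a b xs → Consecutive a b (x ∷ xs)

  Consecutive⇒split : ∀ {a b xs} → Consecutive a b xs → ∃₂ λ ys zs → xs ≡ ys ++ a ∷ b ∷ zs
  Consecutive⇒split (here {xs}) = [] , xs , refl
  Consecutive⇒split (there {x} c) with Consecutive⇒split c
  ... | ys , zs , refl = x ∷ ys , zs , refl

  Consecutive⇒∈ˡ : ∀ {a b xs} → Consecutive a b xs → a ∈ xs
  Consecutive⇒∈ˡ here      = here refl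
  Consecutive⇒∈ˡ (there c) = there (Consecutive⇒∈ˡ c)

  Consecutive⇒∈ʳ : ∀ {a b xs} → Consecutive a b xs → b ∈ xs
  Consecutive⇒∈ʳ here      = there (here refl)
  Consecutive⇒∈ʳ (there c) = there (Consecutive⇒∈ʳ c)

  Consecutive-∷ʳ⇒∈ˡ : ∀ {a b} xs {x} → Consecutive a b (xs ++ [ x ]) → a ∈ xs
  Consecutive-∷ʳ⇒∈ˡ (_ ∷ [])     here      = here refl
  Consecutive-∷ʳ⇒∈ˡ (_ ∷ _ ∷ _)  here      = here refl
  Consecutive-∷ʳ⇒∈ˡ (_ ∷ y ∷ xs) (there c) = there (Consecutive-∷ʳ⇒∈ˡ (y ∷ xs) c)
  Consecutive-∷ʳ⇒∈ˡ (_ ∷ [])     (there (there ()))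
  Consecutive-∷ʳ⇒∈ˡ []           (there ())

  Consecutive-∷⇒∈ʳ : ∀ {a b x xs} → Consecutive a b (x ∷ xs) → b ∈ xs
  Consecutive-∷⇒∈ʳ here      = here refl
  Consecutive-∷⇒∈ʳ (there c) = Consecutive⇒∈ʳ c

  Consecutive-++-∈ : ∀ {a b v xs ys} → Consecutive a b xs → v ∈ ys →
                     Σ[ us ∈ List A ] Σ[ ws ∈ List A ] Σ[ zs ∈ List A ] xs ++ ys ≡ us ++ a ∷ b ∷ ws ++ v ∷ zs
  Consecutive-++-∈ {a} {b} {v} (here {xs}) v∈ with ∈-∃++ v∈
  ... | ws , zs , refl = [] , xs ++ ws , zs , cong (λ l → a ∷ b ∷ l) (sym (++-assoc xs ws (v ∷ zs)))
  Consecutive-++-∈ (there {x} c) v∈ with Consecutive-++-∈ c v∈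
  ... | us , ws , zs , eq = x ∷ us , ws , zs , cong (x ∷_) eq

  ∈-++-Consecutive : ∀ {a b v xs ys} → v ∈ xs → Consecutive a b ys →
                     Σ[ us ∈ List A ] Σ[ ws ∈ List A ] Σ[ zs ∈ List A ] xs ++ ys ≡ us ++ v ∷ ws ++ a ∷ b ∷ zs
  ∈-++-Consecutive {a} {b} {v} v∈ c with ∈-∃++ v∈ | Consecutive⇒split c
  ... | us , ws , refl | ys , zs , refl =
    us , ws ++ ys , zs ,
    trans (++-assoc us (v ∷ ws) (ys ++ a ∷ b ∷ zs)) (cong (λ l → us ++ v ∷ l) (sym (++-assoc ws ys (a ∷ b ∷ zs))))

  consecutive? : DecidableEquality A → ∀ a b xs → Dec (Consecutive a b xs)
  consecutive? _ a b []           = no λ ()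
  consecutive? _ a b (x ∷ [])     = no λ { (there ()) }
  consecutive? _≟ᴬ_ a b (x ∷ y ∷ xs) with x ≟ᴬ a | y ≟ᴬ b | consecutive? _≟ᴬ_ a b (y ∷ xs)
  ... | yes refl | yes refl | _     = yes here
  ... | _        | _        | yes c = yes (there c)
  ... | no x≢a   | _        | no ¬c = no λ { here → x≢a refl ; (there c) → ¬c c }
  ... | yes _    | no y≢b   | no ¬c = no λ { here → y≢b refl ; (there c) → ¬c c }

  Linked-mapConsecutive : ∀ {R S : A → A → Set} {xs} →
                          (∀ {a b} → Consecutive a b xs → R a b → S a b) → Linked R xs → Linked S xs
  Linked-mapConsecutive f []      = []
  Linked-mapConsecutive f [-]     = [-]
  Linked-mapConsecutive f (r ∷ l) = f here r ∷ Linked-mapConsecutive (f ∘ there) l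

module _ {n : ℕ} where

  Permits-endpoints : ∀ {e : Edge n} {a b c d} → Permits e a b → Permits e c d →
                      (a ≡ c × b ≡ d) ⊎ (a ≡ d × b ≡ c)
  Permits-endpoints dirP  dirP  = inj₁ (refl , refl)
  Permits-endpoints undP₁ undP₁ = inj₁ (refl , refl)
  Permits-endpoints undP₁ undP₂ = inj₂ (refl , refl)
  Permits-endpoints undP₂ undP₁ = inj₂ (refl , refl)
  Permits-endpoints undP₂ undP₂ = inj₁ (refl , refl)

  Joins-Permits : ∀ {e : Edge n} {v w x y} → Joins e v w → Permits e x y →
                  (x ≡ v × y ≡ w) ⊎ (x ≡ w × y ≡ v)
  Joins-Permits dirJ₁ dirP  = inj₁ (refl , refl)
  Joins-Permits dirJ₂ dirP  = inj₂ (refl , refl)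
  Joins-Permits undJ₁ undP₁ = inj₁ (refl , refl)
  Joins-Permits undJ₁ undP₂ = inj₂ (refl , refl)
  Joins-Permits undJ₂ undP₁ = inj₂ (refl , refl)
  Joins-Permits undJ₂ undP₂ = inj₁ (refl , refl)

  Permits⇒Joins : ∀ {e : Edge n} {x y} → Permits e x y → Joins e x y
  Permits⇒Joins dirP  = dirJ₁
  Permits⇒Joins undP₁ = undJ₁
  Permits⇒Joins undP₂ = undJ₂

  Joins-sym : ∀ {e : Edge n} {x y} → Joins e x y → Joins e y x
  Joins-sym dirJ₁ = dirJ₂
  Joins-sym dirJ₂ = dirJ₁
  Joins-sym undJ₁ = undJ₂
  Joins-sym undJ₂ = undJ₁

  OArc⇒Permits : ∀ {e : Edge n} {d a b} → OArc e d a b → Permits e a b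
  OArc⇒Permits dirA = dirP
  OArc⇒Permits fwdA = undP₁
  OArc⇒Permits bwdA = undP₂

  OArc-antisym : ∀ {e : Edge n} {d a b} → OArc e d a b → OArc e d b a → a ≡ b
  OArc-antisym dirA dirA = refl
  OArc-antisym fwdA fwdA = refl
  OArc-antisym bwdA bwdA = refl

  OArc-no-return : ∀ {e : Edge n} {d u v w} → OArc e d u v → OArc e d v w → u ≡ v
  OArc-no-return a₁ a₂ with Permits-endpoints (OArc⇒Permits a₁) (OArc⇒Permits a₂)
  ... | inj₁ (u≡v , _)  = u≡v
  ... | inj₂ (refl , _) = OArc-antisym a₁ a₂

  -- So a local orientation cannot depend on the proof that a non-loop edge is incident to v.
  Incident-irrelevant : ∀ {e : Edge n} {d x y v} → OArc e d x y → x ≢ y → (i j : Incident v e) → i ≡ j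
  Incident-irrelevant dirA _   (_ , dirJ₁) (_ , dirJ₁) = refl
  Incident-irrelevant dirA x≢y (_ , dirJ₁) (_ , dirJ₂) = ⊥-elim (x≢y refl)
  Incident-irrelevant dirA x≢y (_ , dirJ₂) (_ , dirJ₁) = ⊥-elim (x≢y refl)
  Incident-irrelevant dirA _   (_ , dirJ₂) (_ , dirJ₂) = refl
  Incident-irrelevant fwdA _   (_ , undJ₁) (_ , undJ₁) = refl
  Incident-irrelevant fwdA x≢y (_ , undJ₁) (_ , undJ₂) = ⊥-elim (x≢y refl)
  Incident-irrelevant fwdA x≢y (_ , undJ₂) (_ , undJ₁) = ⊥-elim (x≢y refl)
  Incident-irrelevant fwdA _   (_ , undJ₂) (_ , undJ₂) = refl
  Incident-irrelevant bwdA _   (_ , undJ₁) (_ , undJ₁) = refl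
  Incident-irrelevant bwdA x≢y (_ , undJ₁) (_ , undJ₂) = ⊥-elim (x≢y refl)
  Incident-irrelevant bwdA x≢y (_ , undJ₂) (_ , undJ₁) = ⊥-elim (x≢y refl)
  Incident-irrelevant bwdA _   (_ , undJ₂) (_ , undJ₂) = refl

  joins? : ∀ (e : Edge n) v w → Dec (Joins e v w)
  joins? (dir a b) v w =
    map′ (λ { (inj₁ (refl , refl)) → dirJ₁ ; (inj₂ (refl , refl)) → dirJ₂ })
         (λ { dirJ₁ → inj₁ (refl , refl) ; dirJ₂ → inj₂ (refl , refl) })
         ((a ≟ v ×-dec b ≟ w) ⊎-dec (b ≟ v ×-dec a ≟ w))
  joins? (undir a b) v w =
    map′ (λ { (inj₁ (refl , refl)) → undJ₁ ; (inj₂ (refl , refl)) → undJ₂ })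
         (λ { undJ₁ → inj₁ (refl , refl) ; undJ₂ → inj₂ (refl , refl) })
         ((a ≟ v ×-dec b ≟ w) ⊎-dec (b ≟ v ×-dec a ≟ w))

  incident? : ∀ (v : Fin n) e → Dec (Incident v e)
  incident? v e = any? (joins? e v)

  oArc? : ∀ (e : Edge n) d x y → Dec (OArc e d x y)
  oArc? (dir a b) d x y =
    map′ (λ { (refl , refl) → dirA }) (λ { dirA → refl , refl }) (a ≟ x ×-dec b ≟ y)
  oArc? (undir a b) true x y =
    map′ (λ { (refl , refl) → fwdA }) (λ { fwdA → refl , refl }) (a ≟ x ×-dec b ≟ y)
  oArc? (undir a b) false x y =
    map′ (λ { (refl , refl) → bwdA }) (λ { bwdA → refl , refl }) (b ≟ x ×-dec a ≟ y)

  IsFirst-IsLast-sole : ∀ {P : Fin n → Set} {p x y} → Unique p → IsFirst P p x → IsLast P p x →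
                        y ∈ p → P y → y ≡ x
  IsFirst-IsLast-sole u (pre , r , refl , _ , ¬P-pre) (pre′ , post , eq , _ , ¬P-post) y∈ Py
    with ∈-++⁻ pre y∈
  ... | inj₁ y∈pre        = ⊥-elim (All.lookup ¬P-pre y∈pre Py)
  ... | inj₂ (here y≡x)   = y≡x
  ... | inj₂ (there y∈r) rewrite Unique-split-suffix pre pre′ u eq =
    ⊥-elim (All.lookup ¬P-post y∈r Py)

  module _ {R : Fin n → Fin n → Set} where

    Linked⇒IsPathIn : ∀ {s t} xs → Linked R xs → head xs ≡ just s → last xs ≡ just t →
                      Σ[ zs ∈ List (Fin n) ] IsPathIn R s t zs × length zs ≤ length xs × zs ⊆ xs
    Linked⇒IsPathIn (x ∷ xs) l refl la with shortcut _≟_ x xs l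
    ... | zs , u , lz , la′ , le , sub = x ∷ zs , (u , lz , refl , trans la′ la) , s≤s le , sub

    Linked-meet⇒IsPathIn : ∀ {x s t} xs ys → Linked R xs → Linked R ys → head xs ≡ just s → last ys ≡ just t →
                           x ∈ xs → x ∈ ys → Σ[ zs ∈ List (Fin n) ] IsPathIn R s t zs × zs ⊆ xs ++ ys
    Linked-meet⇒IsPathIn {x} xs ys lx ly hx lay x∈xs x∈ys with ∈-∃++ x∈xs | ∈-∃++ x∈ys
    ... | xs₁ , xs₂ , refl | ys₁ , ys₂ , refl =
      let zs , zs-path , _ , zs⊆ = Linked⇒IsPathIn (xs₁ ++ x ∷ ys₂) joined
                                     (trans (head-++-∷ xs₁) hx) (trans (last-++-∷ xs₁) (trans (sym (last-++-∷ ys₁)) lay))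
      in  zs , zs-path , within ∘ zs⊆
      where
      joined : Linked R (xs₁ ++ x ∷ ys₂)
      joined = Linked-++⁺ xs₁ (Linked-++⁻ˡ xs₁ lx) (Linked-++⁻ʳ ys₁ ly)
      within : xs₁ ++ x ∷ ys₂ ⊆ (xs₁ ++ x ∷ xs₂) ++ ys₁ ++ x ∷ ys₂
      within z∈ with ∈-++⁻ xs₁ z∈
      ... | inj₁ z∈xs₁ = ∈-++⁺ˡ (∈-++⁺ˡ z∈xs₁)
      ... | inj₂ z∈ys₂ = ∈-++⁺ʳ (xs₁ ++ x ∷ xs₂) (∈-++⁺ʳ ys₁ z∈ys₂)

module _ {n : ℕ} (G : MixedGraph n) where

  Walk-++ : ∀ {a b c vs ws es fs} → Walk G a b vs es → Walk G b c (b ∷ ws) fs →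
            Walk G a c (vs ++ ws) (es ++ fs)
  Walk-++ here         w′ = w′
  Walk-++ (step i p w) w′ = step i p (Walk-++ w w′)

  Walk-edge-endpoints : ∀ {a b vs es i} → Walk G a b vs es → i ∈ es →
                        Σ[ c ∈ Fin n ] Σ[ d ∈ Fin n ] Permits (edge G i) c d × c ∈ vs × d ∈ vs
  Walk-edge-endpoints (step i p here)           (here refl) = _ , _ , p , here refl , there (here refl)
  Walk-edge-endpoints (step i p (step _ _ _))   (here refl) = _ , _ , p , here refl , there (here refl)
  Walk-edge-endpoints (step _ _ w)              (there i∈) with Walk-edge-endpoints w i∈
  ... | c , d , p , c∈ , d∈ = c , d , p , there c∈ , there d∈

  Walk-avoids : ∀ {a b vs es g x y} → Walk G a b vs es → Joins (edge G g) x y → x ∉ vs → g ∉ es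
  Walk-avoids w J x∉ g∈ with Walk-edge-endpoints w g∈
  ... | c , d , p , c∈ , d∈ with Joins-Permits J p
  ... | inj₁ (refl , _) = x∉ c∈
  ... | inj₂ (_ , refl) = x∉ d∈

  Walk-edges-unique : ∀ {a b vs es} → Walk G a b vs es → Unique vs → Unique es
  Walk-edges-unique here         _         = []
  Walk-edges-unique (step i p w) (a∉ ∷ u) =
    Unique-∷⁺ (Walk-avoids w (Permits⇒Joins p) (All¬⇒¬Any a∉)) (Walk-edges-unique w u)

  Linked⇒Walk : ∀ {x xs z} → Linked (Adj G) (x ∷ xs) → last (x ∷ xs) ≡ just z →
                Σ[ es ∈ List (Fin (m G)) ] Walk G x z (x ∷ xs) es
  Linked⇒Walk [-]           refl = [] , here
  Linked⇒Walk ((i , p) ∷ l) eq   with Linked⇒Walk l eq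
  ... | es , w = i ∷ es , step i p w

  Acyclic⇒¬loop : Acyclic G → ∀ {i x} → ¬ Permits (edge G i) x x
  Acyclic⇒¬loop ac {i} {x} p = ac (x , x ∷ [] , i ∷ [] , step i p here , (λ ()) , [] ∷ [] , [] ∷ [])

  path-closes-cycle : ∀ {u v w ys} → IsPath G w u ys → v ∉ ys →
                      ∀ {g₁ g₂} → Permits (edge G g₁) u v → Permits (edge G g₂) v w → g₁ ≢ g₂ → Cycle G
  path-closes-cycle {u} {v} {w} {w′ ∷ ys} (uys , lys , refl , la) v∉ {g₁} {g₂} p₁ p₂ g₁≢g₂
    with Linked⇒Walk lys la
  ... | es , wk =
    v , (w ∷ ys) ++ [ v ] , g₂ ∷ es ++ [ g₁ ] ,
    step g₂ p₂ (Walk-++ wk (step g₁ p₁ here)) , ≢[] ys ,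
    Unique-++⁺ uys ([] ∷ []) (λ { (v∈ , here refl) → v∉ v∈ }) ,
    Unique-∷⁺ g₂∉ (Unique-++⁺ (Walk-edges-unique wk uys) ([] ∷ []) λ { (g₁∈ , here refl) → g₁∉ g₁∈ })
    where
    ≢[] : ∀ zs → (w ∷ zs) ++ [ v ] ≢ []
    ≢[] _ ()
    g₁∉ : g₁ ∉ es
    g₁∉ = Walk-avoids wk (Joins-sym (Permits⇒Joins p₁)) v∉
    g₂∉ : g₂ ∉ es ++ [ g₁ ]
    g₂∉ g₂∈ with ∈-++⁻ es g₂∈
    ... | inj₁ g₂∈es       = Walk-avoids wk (Permits⇒Joins p₂) v∉ g₂∈es
    ... | inj₂ (here refl) = g₁≢g₂ refl

  IsShortestPath⇒Linked : ∀ {s t p} → IsShortestPath G s t p → Linked (Adj G) p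
  IsShortestPath⇒Linked ((_ , l , _) , _) = l

  IsShortestPath-segment : ∀ {s t p} → IsShortestPath G s t p →
                           ∀ xs {x ys y zs ys′} → p ≡ xs ++ x ∷ ys ++ y ∷ zs →
                           Linked (Adj G) (x ∷ ys′ ++ [ y ]) → length ys ≤ length ys′
  IsShortestPath-segment {t = t} ((_ , lp , hp , lap) , minimal) xs {x} {ys} {y} {zs} {ys′} refl l′ =
    let q , q-path , q≤ , _ = Linked⇒IsPathIn (xs ++ x ∷ ys′ ++ y ∷ zs) detour (trans (head-++-∷ xs) hp) last-detour
    in  s≤s⁻¹ (length-++-cancel xs (x ∷ ys) (x ∷ ys′) (y ∷ zs) (≤-trans (minimal q q-path) q≤))
    where
    detour : Linked (Adj G) (xs ++ x ∷ ys′ ++ y ∷ zs)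
    detour = Linked-++⁺ xs (Linked-++⁻ˡ xs lp) (Linked-++⁺ (x ∷ ys′) l′
               (Linked-++⁻ʳ (xs ++ x ∷ ys) (subst (Linked (Adj G)) (sym (++-assoc xs (x ∷ ys) (y ∷ zs))) lp)))
    last-via : ∀ us → last (xs ++ x ∷ us ++ y ∷ zs) ≡ last (y ∷ zs)
    last-via us = trans (cong last (sym (++-assoc xs (x ∷ us) (y ∷ zs)))) (last-++-∷ (xs ++ x ∷ us))
    last-detour : last (xs ++ x ∷ ys′ ++ y ∷ zs) ≡ just t
    last-detour = trans (last-via ys′) (trans (sym (last-via ys)) lap)

  opposite-approach : ∀ {s₁ t₁ s₂ t₂ p₁ p₂} → IsShortestPath G s₁ t₁ p₁ → IsShortestPath G s₂ t₂ p₂ →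
                      ∀ {a b v} us₁ ws₁ zs₁ us₂ ws₂ zs₂ →
                      p₁ ≡ us₁ ++ a ∷ b ∷ ws₁ ++ v ∷ zs₁ → p₂ ≡ us₂ ++ b ∷ a ∷ ws₂ ++ v ∷ zs₂ → ⊥
  opposite-approach sp₁ sp₂ us₁ ws₁ zs₁ us₂ ws₂ zs₂ refl refl =
    <-asym (IsShortestPath-segment sp₁ us₁ refl (detour us₂ (IsShortestPath⇒Linked sp₂)))
           (IsShortestPath-segment sp₂ us₂ refl (detour us₁ (IsShortestPath⇒Linked sp₁)))
    where
    detour : ∀ us {x y ws v zs} → Linked (Adj G) (us ++ x ∷ y ∷ ws ++ v ∷ zs) → Linked (Adj G) (y ∷ ws ++ [ v ])
    detour us l = Linked-++⁻ˡ (_ ∷ _) (Linked.tail (Linked-++⁻ʳ us l))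

  opposite-departure : ∀ {s₁ t₁ s₂ t₂ p₁ p₂} → IsShortestPath G s₁ t₁ p₁ → IsShortestPath G s₂ t₂ p₂ →
                       ∀ {a b v} us₁ ws₁ zs₁ us₂ ws₂ zs₂ →
                       p₁ ≡ us₁ ++ v ∷ ws₁ ++ a ∷ b ∷ zs₁ → p₂ ≡ us₂ ++ v ∷ ws₂ ++ b ∷ a ∷ zs₂ → ⊥
  opposite-departure sp₁ sp₂ {a} {b} {v} us₁ ws₁ zs₁ us₂ ws₂ zs₂ refl refl =
    <-asym (subst (_≤ length ws₂) (length-∷ʳ ws₁)
              (IsShortestPath-segment sp₁ us₁ (regroup us₁ ws₁) (detour us₂ (IsShortestPath⇒Linked sp₂))))
           (subst (_≤ length ws₁) (length-∷ʳ ws₂)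
              (IsShortestPath-segment sp₂ us₂ (regroup us₂ ws₂) (detour us₁ (IsShortestPath⇒Linked sp₁))))
    where
    regroup : ∀ us ws {x y zs} → us ++ v ∷ ws ++ x ∷ y ∷ zs ≡ us ++ v ∷ (ws ++ [ x ]) ++ y ∷ zs
    regroup us ws {x} {y} {zs} = cong (λ l → us ++ v ∷ l) (sym (++-assoc ws [ x ] (y ∷ zs)))
    detour : ∀ us {ws x y zs} → Linked (Adj G) (us ++ v ∷ ws ++ x ∷ y ∷ zs) → Linked (Adj G) (v ∷ ws ++ [ x ])
    detour us {ws} l = Linked-++⁻ˡ (v ∷ ws) (Linked-++⁻ʳ us l)
    length-∷ʳ : ∀ (ws : List (Fin n)) {x} → length (ws ++ [ x ]) ≡ suc (length ws)
    length-∷ʳ ws = trans (length-++ ws) (+-comm (length ws) 1)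

module Extension {n} (G : MixedGraph n) (acyclic : Acyclic G) {k} (path : Fin k → List (Fin n))
                 (s t : Fin k → Fin n) (shortest : ∀ j → IsShortestPath G (s j) (t j) (path j))
                 (v : Fin n) (o′ : LocalOrientation G v) where

  open import Data.List.Membership.DecPropositional (_≟_ {n}) using (_∈?_)

  Local : Fin n → Set
  Local = InLocal G v

  local? : ∀ x → Dec (Local x)
  local? x = x ≟ v ⊎-dec any? (λ i → joins? (edge G i) v x)

  Local-v : Local v
  Local-v = inj₁ refl

  ∈⇒Any-Local : ∀ {p} → v ∈ p → Any Local p
  ∈⇒Any-Local = Any.map (λ { refl → Local-v })

  Adj-into-v : ∀ {a} → Adj G a v → Local a
  Adj-into-v (i , p) = inj₂ (i , Joins-sym (Permits⇒Joins p))

  Adj-out-of-v : ∀ {b} → Adj G v b → Local b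
  Adj-out-of-v (i , p) = inj₂ (i , Permits⇒Joins p)

  Incident⇒Local : ∀ {i a b} → Incident v (edge G i) → Permits (edge G i) a b → Local a × Local b
  Incident⇒Local {i} (w , J) p with Joins-Permits J p
  ... | inj₁ (refl , refl) = Local-v , inj₂ (i , J)
  ... | inj₂ (refl , refl) = inj₂ (i , J) , Local-v

  LocalArc-ends : ∀ {x y} → LocalArc G v o′ x y → (x ≡ v × Local y) ⊎ (Local x × y ≡ v)
  LocalArc-ends (i , (w , J) , arc) with Joins-Permits J (OArc⇒Permits arc)
  ... | inj₁ (refl , refl) = inj₁ (refl , inj₂ (i , J))
  ... | inj₂ (refl , refl) = inj₂ (inj₂ (i , J) , refl)

  LocalArc⇒Local : ∀ {x y} → LocalArc G v o′ x y → Local y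
  LocalArc⇒Local arc with LocalArc-ends arc
  ... | inj₁ (_ , local-y) = local-y
  ... | inj₂ (_ , refl)    = Local-v

  Linked-LocalArc⇒All-Local : ∀ {x xs} → Local x → Linked (LocalArc G v o′) (x ∷ xs) → All Local (x ∷ xs)
  Linked-LocalArc⇒All-Local local-x [-]       = local-x ∷ []
  Linked-LocalArc⇒All-Local local-x (arc ∷ l) = local-x ∷ Linked-LocalArc⇒All-Local (LocalArc⇒Local arc) l

  OArc⇒≢ : ∀ {i d x y} → OArc (edge G i) d x y → x ≢ y
  OArc⇒≢ arc refl = Acyclic⇒¬loop G acyclic (OArc⇒Permits arc)

  extend : (Fin (m G) → Bool) → Orientation G
  extend d i with incident? v (edge G i)
  ... | yes inc = o′ i inc
  ... | no _    = d i

  LocalArc⇒Arc : ∀ d {x y} → LocalArc G v o′ x y → Arc G (extend d) x y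
  LocalArc⇒Arc d {x} {y} (i , inc , arc) = i , oriented
    where
    oriented : OArc (edge G i) (extend d i) x y
    oriented with incident? v (edge G i)
    ... | yes inc₀ = subst (λ c → OArc (edge G i) (o′ i c) x y) (Incident-irrelevant arc (OArc⇒≢ arc) inc inc₀) arc
    ... | no ¬inc  = ⊥-elim (¬inc inc)

  OArc⇒OArc-extend : ∀ d {i x y} → ¬ Incident v (edge G i) → OArc (edge G i) (d i) x y →
                     OArc (edge G i) (extend d i) x y
  OArc⇒OArc-extend d {i} ¬inc arc with incident? v (edge G i)
  ... | yes inc = ⊥-elim (¬inc inc)
  ... | no _    = arc

  -- Only the arcs of oᵥ at v are ever used, so the default for the other edges is irrelevant.
  oᵥ : Orientation G
  oᵥ = extend (λ _ → true)

  upToFirstLocal : List (Fin n) → List (Fin n)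
  upToFirstLocal []       = []
  upToFirstLocal (x ∷ xs) with local? x
  ... | yes _ = [ x ]
  ... | no _  = x ∷ upToFirstLocal xs

  fromLastLocal : List (Fin n) → List (Fin n)
  fromLastLocal []       = []
  fromLastLocal (x ∷ xs) with Any.any? local? xs
  ... | yes _ = fromLastLocal xs
  ... | no _  = x ∷ xs

  upToFirstLocal-split : ∀ p → Any Local p →
                    Σ[ pre ∈ List (Fin n) ] Σ[ u ∈ Fin n ] Σ[ r ∈ List (Fin n) ]
                      (p ≡ pre ++ u ∷ r × upToFirstLocal p ≡ pre ++ [ u ] × All (λ y → ¬ Local y) pre × Local u)
  upToFirstLocal-split (x ∷ xs) any with local? x
  ... | yes local-x = [] , x , xs , refl , refl , [] , local-x
  upToFirstLocal-split (x ∷ xs) (here local-x) | no ¬local-x = ⊥-elim (¬local-x local-x)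
  upToFirstLocal-split (x ∷ xs) (there any)    | no ¬local-x with upToFirstLocal-split xs any
  ... | pre , u , r , e₁ , e₂ , ¬local , local-u =
    x ∷ pre , u , r , cong (x ∷_) e₁ , cong (x ∷_) e₂ , ¬local-x ∷ ¬local , local-u

  fromLastLocal-split : ∀ p → Any Local p →
                    Σ[ pre ∈ List (Fin n) ] Σ[ w ∈ Fin n ] Σ[ post ∈ List (Fin n) ]
                      (p ≡ pre ++ w ∷ post × fromLastLocal p ≡ w ∷ post × All (λ y → ¬ Local y) post × Local w)
  fromLastLocal-split (x ∷ xs) any with Any.any? local? xs
  ... | yes any′ with fromLastLocal-split xs any′
  ...   | pre , w , post , e₁ , e₂ , ¬local , local-w = x ∷ pre , w , post , cong (x ∷_) e₁ , e₂ , ¬local , local-w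
  fromLastLocal-split (x ∷ xs) (here local-x) | no ¬any = [] , x , xs , refl , refl , ¬Any⇒All¬ xs ¬any , local-x
  fromLastLocal-split (x ∷ xs) (there any)    | no ¬any = ⊥-elim (¬any any)

  EntryArc ExitArc : Maybe (Fin n) → Set
  EntryArc nothing  = ⊥
  EntryArc (just u) = u ≢ v × Arc G oᵥ u v
  ExitArc nothing   = ⊥
  ExitArc (just w)  = w ≢ v × Arc G oᵥ v w

  -- Membership in S is not decidable, so the orientation outside G_v is driven by these
  -- decidable conditions, which a satisfied request fulfils as soon as it has a vertex
  -- before (resp. after) G_v.
  Enters Leaves : List (Fin n) → Set
  Enters p = v ∈ p × EntryArc (last (upToFirstLocal p))
  Leaves p = v ∈ p × ExitArc (head (fromLastLocal p))

  arc? : ∀ o a b → Dec (Arc G o a b)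
  arc? o a b = any? λ i → oArc? (edge G i) (o i) a b

  entryArc? : ∀ u → Dec (EntryArc u)
  entryArc? nothing  = no λ ()
  entryArc? (just u) = ¬? (u ≟ v) ×-dec arc? oᵥ u v

  exitArc? : ∀ w → Dec (ExitArc w)
  exitArc? nothing  = no λ ()
  exitArc? (just w) = ¬? (w ≟ v) ×-dec arc? oᵥ v w

  Forced : Fin n → Fin n → Set
  Forced a b = Σ[ j ∈ Fin k ] (Enters (path j) × Consecutive a b (upToFirstLocal (path j))
                             ⊎ Leaves (path j) × Consecutive a b (fromLastLocal (path j)))

  forced? : ∀ a b → Dec (Forced a b)
  forced? a b = any? λ j →
    ((v ∈? path j ×-dec entryArc? _) ×-dec consecutive? _≟_ a b _) ⊎-dec
    ((v ∈? path j ×-dec exitArc? _) ×-dec consecutive? _≟_ a b _)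

  byForcing : Edge n → Bool
  byForcing (dir _ _)   = true
  byForcing (undir a b) = does (forced? a b)

  o : Orientation G
  o = extend (λ i → byForcing (edge G i))

  linked : ∀ j → Linked (Adj G) (path j)
  linked j = IsShortestPath⇒Linked G (shortest j)

  entry-segment : ∀ {p a b} → Enters p → Consecutive a b (upToFirstLocal p) →
                  Σ[ us ∈ List (Fin n) ] Σ[ ws ∈ List (Fin n) ] Σ[ zs ∈ List (Fin n) ] p ≡ us ++ a ∷ b ∷ ws ++ v ∷ zs
  entry-segment {p} (v∈ , entry) c with upToFirstLocal-split p (∈⇒Any-Local v∈)
  ... | pre , u , r , refl , e , ¬local , _ =
    let us , ws , zs , eq = Consecutive-++-∈ (subst (Consecutive _ _) e c) v∈r
    in  us , ws , zs , trans (sym (++-assoc pre [ u ] r)) eq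
    where
    v∈r : v ∈ r
    v∈r with ∈-++⁻ pre v∈
    ... | inj₁ v∈pre      = ⊥-elim (All.lookup ¬local v∈pre Local-v)
    ... | inj₂ (here v≡u) = ⊥-elim (proj₁ (subst EntryArc (trans (cong last e) (last-++-∷ pre)) entry) (sym v≡u))
    ... | inj₂ (there v∈) = v∈

  exit-segment : ∀ {p a b} → Leaves p → Consecutive a b (fromLastLocal p) →
                 Σ[ us ∈ List (Fin n) ] Σ[ ws ∈ List (Fin n) ] Σ[ zs ∈ List (Fin n) ] p ≡ us ++ v ∷ ws ++ a ∷ b ∷ zs
  exit-segment {p} (v∈ , exit) c with fromLastLocal-split p (∈⇒Any-Local v∈)
  ... | pre , w , post , refl , e , ¬local , _ = ∈-++-Consecutive v∈pre (subst (Consecutive _ _) e c)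
    where
    v∈pre : v ∈ pre
    v∈pre with ∈-++⁻ pre v∈
    ... | inj₁ v∈pre       = v∈pre
    ... | inj₂ (here v≡w)  = ⊥-elim (proj₁ (subst ExitArc (cong head e) exit) (sym v≡w))
    ... | inj₂ (there v∈)  = ⊥-elim (All.lookup ¬local v∈ Local-v)

  entry-exit-cycle : ∀ {p₁ p₂ x} → Linked (Adj G) p₁ → Enters p₁ → x ∈ upToFirstLocal p₁ →
                     Linked (Adj G) p₂ → Leaves p₂ → x ∈ fromLastLocal p₂ → Cycle G
  entry-exit-cycle {p₁} {p₂} {x} l₁ (v∈₁ , entry) x∈₁ l₂ (v∈₂ , exit) x∈₂
    with upToFirstLocal-split p₁ (∈⇒Any-Local v∈₁) | fromLastLocal-split p₂ (∈⇒Any-Local v∈₂)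
  ... | pre , u , r , refl , e₁ , ¬local₁ , _ | pre′ , w , post , refl , e₂ , ¬local₂ , _
    with subst EntryArc (trans (cong last e₁) (last-++-∷ pre)) entry | subst ExitArc (cong head e₂) exit
  ... | u≢v , g₁ , a₁ | w≢v , g₂ , a₂ =
    let zs , zs-path , zs⊆ = Linked-meet⇒IsPathIn (w ∷ post) (pre ++ [ u ])
                               (Linked-++⁻ʳ pre′ l₂) (Linked-++⁻ˡ pre l₁) refl (last-++-∷ pre)
                               (subst (x ∈_) e₂ x∈₂) (subst (x ∈_) e₁ x∈₁)
    in  path-closes-cycle G zs-path (v∉ ∘ zs⊆) (OArc⇒Permits a₁) (OArc⇒Permits a₂)
          (λ { refl → u≢v (OArc-no-return a₁ a₂) })
    where
    v∉ : v ∉ (w ∷ post) ++ pre ++ [ u ]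
    v∉ (here v≡w) = w≢v (sym v≡w)
    v∉ (there v∈) with ∈-++⁻ post v∈
    ... | inj₁ v∈post  = All.lookup ¬local₂ v∈post Local-v
    ... | inj₂ v∈entry with ∈-++⁻ pre v∈entry
    ...   | inj₁ v∈pre      = All.lookup ¬local₁ v∈pre Local-v
    ...   | inj₂ (here v≡u) = u≢v (sym v≡u)

  Forced-asym : ∀ {a b} → Forced a b → Forced b a → ⊥
  Forced-asym (j₁ , inj₁ (en₁ , c₁)) (j₂ , inj₁ (en₂ , c₂))
    with entry-segment en₁ c₁ | entry-segment en₂ c₂
  ... | us₁ , ws₁ , zs₁ , eq₁ | us₂ , ws₂ , zs₂ , eq₂ =
    opposite-approach G (shortest j₁) (shortest j₂) us₁ ws₁ zs₁ us₂ ws₂ zs₂ eq₁ eq₂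
  Forced-asym (j₁ , inj₂ (le₁ , c₁)) (j₂ , inj₂ (le₂ , c₂))
    with exit-segment le₁ c₁ | exit-segment le₂ c₂
  ... | us₁ , ws₁ , zs₁ , eq₁ | us₂ , ws₂ , zs₂ , eq₂ =
    opposite-departure G (shortest j₁) (shortest j₂) us₁ ws₁ zs₁ us₂ ws₂ zs₂ eq₁ eq₂
  Forced-asym (j₁ , inj₁ (en₁ , c₁)) (j₂ , inj₂ (le₂ , c₂)) =
    acyclic (entry-exit-cycle (linked j₁) en₁ (Consecutive⇒∈ʳ c₁) (linked j₂) le₂ (Consecutive⇒∈ˡ c₂))
  Forced-asym (j₁ , inj₂ (le₁ , c₁)) (j₂ , inj₁ (en₂ , c₂)) =
    acyclic (entry-exit-cycle (linked j₂) en₂ (Consecutive⇒∈ʳ c₂) (linked j₁) le₁ (Consecutive⇒∈ˡ c₁))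

  Forced⇒OArc : ∀ e {a b} → Permits e a b → Forced a b → OArc e (byForcing e) a b
  Forced⇒OArc (dir _ _)   dirP  _ = dirA
  Forced⇒OArc (undir a b) undP₁ f with forced? a b
  ... | yes _ = fwdA
  ... | no ¬f = ⊥-elim (¬f f)
  Forced⇒OArc (undir a b) undP₂ f with forced? a b
  ... | yes f′ = ⊥-elim (Forced-asym f′ f)
  ... | no _   = bwdA

  first-local-arc : ∀ {x y ys} → x ≢ v → Linked (LocalArc G v o′) (x ∷ y ∷ ys) → Arc G oᵥ x v
  first-local-arc x≢v (arc ∷ _) with LocalArc-ends arc
  ... | inj₁ (x≡v , _) = ⊥-elim (x≢v x≡v)
  ... | inj₂ (_ , refl) = LocalArc⇒Arc _ arc

  last-local-arc : ∀ {x y ys z} → z ≢ v → Linked (LocalArc G v o′) (x ∷ y ∷ ys) → last (y ∷ ys) ≡ just z →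
                   Arc G oᵥ v z
  last-local-arc z≢v l la with Linked-last-step l la
  ... | _ , arc with LocalArc-ends arc
  ...   | inj₁ (refl , _) = LocalArc⇒Arc _ arc
  ...   | inj₂ (_ , z≡v)  = ⊥-elim (z≢v z≡v)

  entry-oriented : ∀ j → Enters (path j) → Linked (Arc G o) (upToFirstLocal (path j))
  entry-oriented j en with upToFirstLocal-split (path j) (∈⇒Any-Local (proj₁ en))
  ... | pre , _ , _ , e₁ , e₂ , ¬local , _ =
    Linked-mapConsecutive orient
      (subst (Linked (Adj G)) (sym e₂) (Linked-++⁻ˡ pre (subst (Linked (Adj G)) e₁ (linked j))))
    where
    orient : ∀ {a b} → Consecutive a b (upToFirstLocal (path j)) → Adj G a b → Arc G o a b
    orient c (i , p) = i , OArc⇒OArc-extend _ ¬inc (Forced⇒OArc (edge G i) p (j , inj₁ (en , c)))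
      where
      ¬inc : ¬ Incident v (edge G i)
      ¬inc inc = All.lookup ¬local (Consecutive-∷ʳ⇒∈ˡ pre (subst (Consecutive _ _) e₂ c)) (proj₁ (Incident⇒Local inc p))

  exit-oriented : ∀ j → Leaves (path j) → Linked (Arc G o) (fromLastLocal (path j))
  exit-oriented j le with fromLastLocal-split (path j) (∈⇒Any-Local (proj₁ le))
  ... | pre , _ , _ , e₁ , e₂ , ¬local , _ =
    Linked-mapConsecutive orient
      (subst (Linked (Adj G)) (sym e₂) (Linked-++⁻ʳ pre (subst (Linked (Adj G)) e₁ (linked j))))
    where
    orient : ∀ {a b} → Consecutive a b (fromLastLocal (path j)) → Adj G a b → Arc G o a b
    orient c (i , p) = i , OArc⇒OArc-extend _ ¬inc (Forced⇒OArc (edge G i) p (j , inj₂ (le , c)))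
      where
      ¬inc : ¬ Incident v (edge G i)
      ¬inc inc = All.lookup ¬local (Consecutive-∷⇒∈ʳ (subst (Consecutive _ _) e₂ c)) (proj₂ (Incident⇒Local inc p))

  oriented-path : ∀ j → v ∈ path j → SatisfiesLocal G v o′ (path j) → HasDirPath G o (s j) (t j)
  oriented-path j v∈ satisfies
    with shortest j | upToFirstLocal-split (path j) (∈⇒Any-Local v∈) | fromLastLocal-split (path j) (∈⇒Any-Local v∈)
  ... | (u-p , l-p , h-p , la-p) , _ | pre , s′ , r , e₁ , e₂ , ¬local₁ , local-s′
      | pre′ , t′ , post , f₁ , f₂ , ¬local₂ , local-t′
    with satisfies s′ t′ (pre , r , e₁ , local-s′ , ¬local₁) (pre′ , post , f₁ , local-t′ , ¬local₂)
  ... | .s′ ∷ qt , u-q , l-q , refl , la-q =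
    pre ++ (s′ ∷ qt) ++ post , unique ,
    Linked-splice pre post entry (Linked.map (LocalArc⇒Arc _) l-q) la-q exit ,
    trans (head-++-∷ pre) (trans (cong head (sym e₁)) h-p) ,
    trans (last-splice pre post la-q) (trans (sym (last-++-∷ pre′)) (trans (cong last (sym f₁)) la-p))
    where
    s′≢v : pre ≢ [] → s′ ≢ v
    s′≢v pre≢[] refl with Linked-predecessor pre pre≢[] (subst (Linked (Adj G)) e₁ l-p)
    ... | a , a∈ , adj = All.lookup ¬local₁ a∈ (Adj-into-v adj)
    t′≢v : post ≢ [] → t′ ≢ v
    t′≢v post≢[] refl with Linked-successor pre′ post≢[] (subst (Linked (Adj G)) f₁ l-p)
    ... | b , b∈ , adj = All.lookup ¬local₂ b∈ (Adj-out-of-v adj)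
    -- if s′ = t′, then v is the only vertex of path j in G_v
    s′≢t′ : s′ ≢ v → s′ ≢ t′
    s′≢t′ s′≢v refl = s′≢v (sym (IsFirst-IsLast-sole u-p (pre , r , e₁ , local-s′ , ¬local₁)
                                   (pre′ , post , f₁ , local-t′ , ¬local₂) v∈ Local-v))
    entry-arc : s′ ≢ v → Arc G oᵥ s′ v
    entry-arc s′≢v = first-arc qt l-q la-q
      where
      first-arc : ∀ qs → Linked (LocalArc G v o′) (s′ ∷ qs) → last (s′ ∷ qs) ≡ just t′ → Arc G oᵥ s′ v
      first-arc []      _ la = ⊥-elim (s′≢t′ s′≢v (just-injective la))
      first-arc (_ ∷ _) l _  = first-local-arc s′≢v l
    exit-arc : t′ ≢ v → Arc G oᵥ v t′
    exit-arc t′≢v = last-arc qt l-q la-q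
      where
      last-arc : ∀ qs → Linked (LocalArc G v o′) (s′ ∷ qs) → last (s′ ∷ qs) ≡ just t′ → Arc G oᵥ v t′
      last-arc []      _ la = ⊥-elim (s′≢t′ (subst (_≢ v) (sym (just-injective la)) t′≢v) (just-injective la))
      last-arc (_ ∷ _) l la = last-local-arc t′≢v l la
    entry : Linked (Arc G o) (pre ++ [ s′ ])
    entry = Linked-∷ʳ-cases pre λ pre≢[] → subst (Linked (Arc G o)) e₂ (entry-oriented j
      (v∈ , subst EntryArc (sym (trans (cong last e₂) (last-++-∷ pre))) (s′≢v pre≢[] , entry-arc (s′≢v pre≢[]))))
    exit : Linked (Arc G o) (t′ ∷ post)
    exit = Linked-∷-cases post λ post≢[] → subst (Linked (Arc G o)) f₂ (exit-oriented j
      (v∈ , subst ExitArc (sym (cong head f₂)) (t′≢v post≢[] , exit-arc (t′≢v post≢[]))))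
    local-q : All Local (s′ ∷ qt)
    local-q = Linked-LocalArc⇒All-Local local-s′ l-q
    post⊆r : Σ[ ks ∈ List (Fin n) ] s′ ∷ r ≡ ks ++ t′ ∷ post
    post⊆r = ++-∷-suffix pre pre′ (trans (sym e₁) f₁) (λ t′∈pre → All.lookup ¬local₁ t′∈pre local-t′)
    unique : Unique (pre ++ (s′ ∷ qt) ++ post)
    unique = Unique-++⁺ (Unique-++⁻ˡ pre (subst Unique e₁ u-p))
      (Unique-++⁺ u-q (AllPairs.tail (Unique-++⁻ʳ pre′ (subst Unique f₁ u-p)))
        λ (z∈q , z∈post) → All.lookup ¬local₂ z∈post (All.lookup local-q z∈q))
      λ (z∈pre , z∈rest) → [ (λ z∈q → All.lookup ¬local₁ z∈pre (All.lookup local-q z∈q))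
                           , (λ z∈post → Unique-++⇒disjoint pre (subst Unique e₁ u-p) z∈pre
                                (subst (_ ∈_) (sym (proj₂ post⊆r)) (∈-++⁺ʳ (proj₁ post⊆r) (there z∈post)))) ]′
                           (∈-++⁻ (s′ ∷ qt) z∈rest)

lemma1 : ∀ {n} (G : MixedGraph n) → Acyclic G →
    ∀ {k} (req : Fin k → Fin n × Fin n) → (∀ i j → req i ≡ req j → i ≡ j) →
    (path : Fin k → List (Fin n)) →
    (∀ i → IsShortestPath G (proj₁ (req i)) (proj₂ (req i)) (path i)) →
    (v : Fin n) → (S : Fin k → Set) → (∀ i → S i → v ∈ path i) →
    (Σ[ o′ ∈ LocalOrientation G v ] (∀ i → S i → SatisfiesLocal G v o′ (path i))) →
    Σ[ o ∈ Orientation G ] (∀ i → S i → HasDirPath G o (proj₁ (req i)) (proj₂ (req i)))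
lemma1 G acyclic req _ path shortest v S v∈S-paths (o′ , satisfies) =
  E.o , λ i i∈S → E.oriented-path i (v∈S-paths i i∈S) (satisfies i i∈S)
  where
  module E = Extension G acyclic path (proj₁ ∘ req) (proj₂ ∘ req) shortest v o′
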